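{- Let $v_1, v_2, k, t$ be integers with $v_1, v_2 \geq 0$ and $0 \leq t \leq k \leq v_1 + v_2$. Then $$C(v_1+v_2,k,t) \;\leq\; \sum_{s=\max(0,\,t-v_2)}^{\min(t,\,v_1)} \;\; \min_{\max(s,\,k-v_2)\,\leq\, \ell\, \leq\, \min(k-t+s,\,v_1)} \; C(v_1,\ell,s)\cdot C(v_2,k-\ell,t-s).$$
   Context: For integers $0 \leq t \leq k \leq v$, a $(v,k,t)$ covering design is a family of $k$-element subsets (blocks) of a $v$-element set such that every $t$-element subset is contained in at least one block; $C(v,k,t)$ denotes the minimum number of blocks in such a family. In particular $C(v,k,0)=1$ for $0\le k\le v$ (a single block covers the empty set), and $C(v,v,t)=1$. -}

module Defs where

open import Data.Nat using (ℕ; zero; suc; _+_; _*_; _∸_; _^_; _⊓_)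
open import Data.Bool using (if_then_else_)
open import Data.Fin using (Fin)
open import Data.Fin.Properties using (all?; any?)
open import Data.Fin.Subset using (Subset; _⊆_; ∣_∣)
open import Data.Fin.Subset.Properties using (_⊆?_; anySubset?)
open import Data.Vec using (Vec; []; _∷_; lookup)
open import Data.List using (List; map; applyUpTo; foldr)
open import Data.Nat.ListAction using (sum)
open import Data.Product using (∃; Σ; _×_; _,_; proj₁; proj₂)
open import Data.Nat.Properties using (_≟_)
open import Relation.Nullary using (Dec; yes; no; ¬_; does)
open import Relation.Nullary.Decidable using (_×-dec_; ¬?)
import Relation.Nullary.Decidable as Dec
open import Relation.Binary.PropositionalEquality using (_≡_)

IsCoveringDesign : (v k t : ℕ) {b : ℕ} → Vec (Subset v) b → Set
IsCoveringDesign v k t {b} B =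
  (∀ (i : Fin b) → ∣ lookup B i ∣ ≡ k) ×
  (∀ (T : Subset v) → ∣ T ∣ ≡ t → ∃ λ (i : Fin b) → T ⊆ lookup B i)

HasCoveringDesign : (v k t b : ℕ) → Set
HasCoveringDesign v k t b = ∃ λ (B : Vec (Subset v) b) → IsCoveringDesign v k t B

private
  allSubset? : ∀ {n} {P : Subset n → Set} → (∀ x → Dec (P x)) → Dec (∀ x → P x)
  allSubset? {P = P} P? with anySubset? (λ x → ¬? (P? x))
  ... | yes (x , ¬px) = no (λ h → ¬px (h x))
  ... | no ¬ex = yes (λ x → Dec.decidable-stable (P? x) (λ ¬px → ¬ex (x , ¬px)))

  anyVec? : ∀ {A : Set} {n} (allA : ∀ {Q : A → Set} → (∀ a → Dec (Q a)) → Dec (∃ Q))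
            {P : Vec A n → Set} → (∀ xs → Dec (P xs)) → Dec (∃ P)
  anyVec? {n = zero} allA P? = Dec.map′ (λ p → [] , p) (λ { ([] , p) → p }) (P? [])
  anyVec? {n = suc n} allA {P} P? =
    Dec.map′ (λ { (x , xs , p) → x ∷ xs , p }) (λ { (x ∷ xs , p) → x , xs , p })
      (allA (λ x → anyVec? allA (λ xs → P? (x ∷ xs))))

  isCD? : ∀ v k t {b} (B : Vec (Subset v) b) → Dec (IsCoveringDesign v k t B)
  isCD? v k t B =
    all? (λ i → ∣ lookup B i ∣ ≟ k) ×-dec
    allSubset? (λ T → Dec.map′ (λ f → f) (λ f → f)
      (helper T))
    where
      helper : ∀ T → Dec (∣ T ∣ ≡ t → ∃ λ i → T ⊆ lookup B i)
      helper T with ∣ T ∣ ≟ t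
      ... | no ne = yes (λ e → Data.Empty.⊥-elim (ne e))
        where import Data.Empty
      ... | yes e with any? (λ i → T ⊆? lookup B i)
      ...   | yes p = yes (λ _ → p)
      ...   | no np = no (λ f → np (f e))

hasCoveringDesign? : ∀ v k t b → Dec (HasCoveringDesign v k t b)
hasCoveringDesign? v k t b = anyVec? anySubset? (isCD? v k t)

-- The search runs over b = 0, 1, ..., 2^v; whenever t ≤ k ≤ v a
-- design with at most 2^v blocks exists (all k-subsets), so the search
-- then finds the true minimum.  (Outside that range the value is junk.)
C : ℕ → ℕ → ℕ → ℕ
C v k t = go (suc (2 ^ v)) 0
  where
    go : ℕ → ℕ → ℕ
    go zero b = b
    go (suc fuel) b = if does (hasCoveringDesign? v k t b) then b else go fuel (suc b)

-- the list [a, a+1, ..., b]  (empty if b < a)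
range : ℕ → ℕ → List ℕ
range a b = applyUpTo (a +_) (suc b ∸ a)

sumRange : ℕ → ℕ → (ℕ → ℕ) → ℕ
sumRange a b f = sum (map f (range a b))

-- min_{a ≤ i ≤ b} f i  (intended for a ≤ b; f a is always in the range then)
minRange : ℕ → ℕ → (ℕ → ℕ) → ℕ
minRange a b f = foldr _⊓_ (f a) (map f (range a b))

{-# OPTIONS --safe #-}
-- Split the points into the first v₁ and the last v₂.  A t-set T meets the first part in
-- some s points, t - v₂ ≤ s ≤ min(t, v₁), and the second part in t - s points.  For each
-- such s and each ℓ in the given range, an optimal (v₁, ℓ, s) design and an optimal
-- (v₂, k - ℓ, t - s) design exist (the range of ℓ is exactly what makes s ≤ ℓ ≤ v₁ and
-- t - s ≤ k - ℓ ≤ v₂), and the C(v₁,ℓ,s) · C(v₂,k-ℓ,t-s) unions B₁ ∪ B₂ of their blocks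
-- are k-sets covering every T with |T ∩ first part| = s.  Choosing the best ℓ for every s
-- and taking all these blocks together gives a (v₁ + v₂, k, t) design of the stated size.
module Submission where

open import Defs
open import Data.Nat using (ℕ; zero; suc; _+_; _*_; _∸_; _^_; _≤_; _<_; _⊔_; _⊓_; z≤n; s≤s; s≤s⁻¹; _≤?_)
open import Data.Nat.Properties
open import Data.Nat.ListAction using (sum)
open import Data.Bool using (if_then_else_)
open import Data.Empty using (⊥-elim)
open import Data.Product using (∃-syntax; _×_; _,_; proj₁; proj₂)
open import Data.Sum using (_⊎_; inj₁; inj₂)
open import Data.Fin.Subset using (Subset; _⊆_; ∣_∣; inside; outside; ⊥)
open import Data.Fin.Subset.Properties using (∣p∣≤n; ∣⊥∣≡0; s⊆s; out⊆; drop-∷-⊆)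
open import Data.Vec using (Vec; []; _∷_; _++_; splitAt)
import Data.Vec as Vec
import Data.Vec.Relation.Unary.All.Properties as VecAll
import Data.Vec.Relation.Unary.Any as VecAny
import Data.Vec.Relation.Unary.Any.Properties as VecAnyP
import Data.Vec.Membership.Propositional as VecMembership
open import Data.Vec.Membership.Propositional.Properties using (∈-lookup)
open import Data.Vec.Properties using (length-toList)
open import Data.List using (List; []; _∷_; length; map; replicate; concatMap; cartesianProductWith; foldr)
import Data.List as List
open import Data.List.Properties using (length-map; length-++; length-replicate; map-cong)
open import Data.List.Relation.Unary.All using (All)
import Data.List.Relation.Unary.All as All
import Data.List.Relation.Unary.All.Properties as AllP
open import Data.List.Relation.Unary.Any using (Any; here; there)
import Data.List.Relation.Unary.Any.Properties as AnyP
open import Data.List.Membership.Propositional using (_∈_; lose)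
open import Data.List.Membership.Propositional.Properties using (∈-map⁺; ∈-++⁺ˡ; ∈-++⁺ʳ)
open import Relation.Nullary using (yes; no; does)
open import Relation.Unary using (Pred; Decidable)
open import Relation.Binary.PropositionalEquality

module LinearSearch {p} {P : Pred ℕ p} (P? : Decidable P) (search : ℕ → ℕ → ℕ)
  (search-zero : ∀ b → search zero b ≡ b)
  (search-suc : ∀ fuel b → search (suc fuel) b ≡ (if does (P? b) then b else search fuel (suc b)))
  where

  search-≤ : ∀ fuel {b b′} → b ≤ b′ → P b′ → search fuel b ≤ b′
  search-≤ zero {b} b≤b′ _ rewrite search-zero b = b≤b′
  search-≤ (suc fuel) {b} b≤b′ pb′ rewrite search-suc fuel b with P? b
  ... | yes _ = b≤b′
  ... | no ¬pb with m≤n⇒m<n∨m≡n b≤b′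
  ...   | inj₁ b<b′ = search-≤ fuel b<b′ pb′
  ...   | inj₂ refl = ⊥-elim (¬pb pb′)

  search-sound : ∀ fuel {b b′} → b ≤ b′ → b′ < b + fuel → P b′ → P (search fuel b)
  search-sound zero {b} {b′} b≤b′ b′<b+0 _ =
    ⊥-elim (<⇒≱ (subst (b′ <_) (+-identityʳ b) b′<b+0) b≤b′)
  search-sound (suc fuel) {b} {b′} b≤b′ b′<b+1+fuel pb′ rewrite search-suc fuel b with P? b
  ... | yes pb = pb
  ... | no ¬pb with m≤n⇒m<n∨m≡n b≤b′
  ...   | inj₁ b<b′ = search-sound fuel b<b′ (subst (b′ <_) (+-suc b fuel) b′<b+1+fuel) pb′
  ...   | inj₂ refl = ⊥-elim (¬pb pb′)

  -- `search (suc fuel) 0` unfolded once: the shape to which `C v k t` reduces.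
  search-from-zero-≤ : ∀ fuel {b} → P b → (if does (P? 0) then 0 else search fuel 1) ≤ b
  search-from-zero-≤ fuel pb = subst (_≤ _) (search-suc fuel 0) (search-≤ (suc fuel) z≤n pb)

  search-from-zero-sound : ∀ fuel {b} → b ≤ fuel → P b →
                           P (if does (P? 0) then 0 else search fuel 1)
  search-from-zero-sound fuel b≤fuel pb =
    subst P (search-suc fuel 0) (search-sound (suc fuel) z≤n (s≤s b≤fuel) pb)

-- The search function of C is local to it and cannot be named.  Abstracting 2 ^ v and 1
-- in the (normalised) goal turns it into `go n m` with variables n, m, so the `search`
-- argument, left as `_` before the abstraction, is found by pattern unification.
C-minimal : ∀ {v k t b} → HasCoveringDesign v k t b → C v k t ≤ b
C-minimal {v} {k} {t} design
  with LinearSearch.search-from-zero-≤ (hasCoveringDesign? v k t) _ (λ _ → refl) (λ _ _ → refl)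
... | search-≤ with 2 ^ v | 1
...   | n | _ = search-≤ n design

C-attained : ∀ {v k t} → HasCoveringDesign v k t (2 ^ v) → HasCoveringDesign v k t (C v k t)
C-attained {v} {k} {t}
  with LinearSearch.search-from-zero-sound (hasCoveringDesign? v k t) _ (λ _ → refl) (λ _ _ → refl)
... | search-sound with 2 ^ v | 1
...   | n | _ = search-sound n ≤-refl

∣p++q∣≡∣p∣+∣q∣ : ∀ {m n} (p : Subset m) (q : Subset n) → ∣ p ++ q ∣ ≡ ∣ p ∣ + ∣ q ∣
∣p++q∣≡∣p∣+∣q∣ []            q = refl
∣p++q∣≡∣p∣+∣q∣ (inside ∷ p)  q = cong suc (∣p++q∣≡∣p∣+∣q∣ p q)
∣p++q∣≡∣p∣+∣q∣ (outside ∷ p) q = ∣p++q∣≡∣p∣+∣q∣ p q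

++-⊆ : ∀ {m n} {p₁ q₁ : Subset m} {p₂ q₂ : Subset n} → p₁ ⊆ q₁ → p₂ ⊆ q₂ → p₁ ++ p₂ ⊆ q₁ ++ q₂
++-⊆ {p₁ = []}          {[]}     _     p₂⊆q₂ = p₂⊆q₂
++-⊆ {p₁ = outside ∷ _} {_ ∷ _}  p₁⊆q₁ p₂⊆q₂ = out⊆ (++-⊆ (drop-∷-⊆ p₁⊆q₁) p₂⊆q₂)
++-⊆ {p₁ = inside ∷ _}  {_ ∷ _}  p₁⊆q₁ p₂⊆q₂ with p₁⊆q₁ Vec.here
... | Vec.here = s⊆s (++-⊆ (drop-∷-⊆ p₁⊆q₁) p₂⊆q₂)

addFirst : ∀ {n} → ℕ → Subset n → Subset n
addFirst zero    p             = p
addFirst (suc m) []            = []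
addFirst (suc m) (inside ∷ p)  = inside ∷ addFirst (suc m) p
addFirst (suc m) (outside ∷ p) = inside ∷ addFirst m p

p⊆addFirst : ∀ {n} m (p : Subset n) → p ⊆ addFirst m p
p⊆addFirst zero    p             x∈p = x∈p
p⊆addFirst (suc m) []            ()
p⊆addFirst (suc m) (inside ∷ p)  = s⊆s (p⊆addFirst (suc m) p)
p⊆addFirst (suc m) (outside ∷ p) = out⊆ (p⊆addFirst m p)

∣addFirst∣ : ∀ {n} m (p : Subset n) → ∣ p ∣ + m ≤ n → ∣ addFirst m p ∣ ≡ ∣ p ∣ + m
∣addFirst∣ zero    p             _ = sym (+-identityʳ ∣ p ∣)
∣addFirst∣ (suc m) (inside ∷ p)  (s≤s fits) = cong suc (∣addFirst∣ (suc m) p fits)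
∣addFirst∣ {suc n} (suc m) (outside ∷ p) fits =
  trans (cong suc (∣addFirst∣ m p (s≤s⁻¹ (subst (_≤ suc n) (+-suc ∣ p ∣ m) fits))))
        (sym (+-suc ∣ p ∣ m))

extendTo : ∀ {n} → ℕ → Subset n → Subset n
extendTo k p with ∣ p ∣ ≤? k
... | yes _ = addFirst (k ∸ ∣ p ∣) p
... | no  _ = addFirst k ⊥

∣extendTo∣ : ∀ {n} k (p : Subset n) → k ≤ n → ∣ extendTo k p ∣ ≡ k
∣extendTo∣ {n} k p k≤n with ∣ p ∣ ≤? k
... | yes ∣p∣≤k =
  trans (∣addFirst∣ (k ∸ ∣ p ∣) p (subst (_≤ n) (sym (m+[n∸m]≡n ∣p∣≤k)) k≤n)) (m+[n∸m]≡n ∣p∣≤k)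
... | no  _ =
  trans (∣addFirst∣ k ⊥ (subst (λ c → c + k ≤ n) (sym (∣⊥∣≡0 n)) k≤n)) (cong (_+ k) (∣⊥∣≡0 n))

p⊆extendTo : ∀ {n} k (p : Subset n) → ∣ p ∣ ≤ k → p ⊆ extendTo k p
p⊆extendTo k p ∣p∣≤k with ∣ p ∣ ≤? k
... | yes _    = p⊆addFirst (k ∸ ∣ p ∣) p
... | no  ∣p∣≰k = ⊥-elim (∣p∣≰k ∣p∣≤k)

allSubsets : ∀ n → List (Subset n)
allSubsets zero    = [] ∷ []
allSubsets (suc n) = map (outside ∷_) (allSubsets n) List.++ map (inside ∷_) (allSubsets n)

length-allSubsets : ∀ n → length (allSubsets n) ≡ 2 ^ n
length-allSubsets zero    = refl
length-allSubsets (suc n) = begin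
  length (map (outside ∷_) (allSubsets n) List.++ map (inside ∷_) (allSubsets n))
    ≡⟨ length-++ (map (outside ∷_) (allSubsets n)) ⟩
  length (map (outside ∷_) (allSubsets n)) + length (map (inside ∷_) (allSubsets n))
    ≡⟨ cong₂ _+_ (length-map _ (allSubsets n)) (length-map _ (allSubsets n)) ⟩
  length (allSubsets n) + length (allSubsets n)
    ≡⟨ cong (λ l → l + l) (length-allSubsets n) ⟩
  2 ^ n + 2 ^ n
    ≡⟨ cong (2 ^ n +_) (sym (+-identityʳ (2 ^ n))) ⟩
  2 ^ suc n ∎
  where open ≡-Reasoning

∈-allSubsets : ∀ {n} (p : Subset n) → p ∈ allSubsets n
∈-allSubsets []            = here refl
∈-allSubsets (outside ∷ p) = ∈-++⁺ˡ (∈-map⁺ (outside ∷_) (∈-allSubsets p))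
∈-allSubsets (inside ∷ p)  = ∈-++⁺ʳ _ (∈-map⁺ (inside ∷_) (∈-allSubsets p))

IsCoveringList : (v k t : ℕ) → List (Subset v) → Set
IsCoveringList v k t Bs = All (λ B → ∣ B ∣ ≡ k) Bs × (∀ T → ∣ T ∣ ≡ t → Any (T ⊆_) Bs)

fromList-isCoveringDesign : ∀ {v k t} {Bs : List (Subset v)} →
                            IsCoveringList v k t Bs → IsCoveringDesign v k t (Vec.fromList Bs)
fromList-isCoveringDesign (sizes , covers) =
  VecAll.lookup⁺ (VecAll.fromList⁺ sizes) ,
  λ T ∣T∣≡t → let T⊆B = VecAnyP.fromList⁺ (covers T ∣T∣≡t) in VecAny.index T⊆B , VecAnyP.lookup-index T⊆B

toList-isCoveringList : ∀ {v k t b} {B : Vec (Subset v) b} →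
                        IsCoveringDesign v k t B → IsCoveringList v k t (Vec.toList B)
toList-isCoveringList {B = B} (sizes , covers) =
  VecAll.toList⁺ (VecAll.lookup⁻ sizes) ,
  λ T ∣T∣≡t → let (i , T⊆Bᵢ) = covers T ∣T∣≡t in
              VecAnyP.toList⁺ (VecMembership.lose (∈-lookup i B) T⊆Bᵢ)

C≤length : ∀ {v k t} {Bs : List (Subset v)} → IsCoveringList v k t Bs → C v k t ≤ length Bs
C≤length {Bs = Bs} design = C-minimal (Vec.fromList Bs , fromList-isCoveringDesign design)

extendedSubsets-isCovering : ∀ {v k t} → t ≤ k → k ≤ v →
                             IsCoveringList v k t (map (extendTo k) (allSubsets v))
extendedSubsets-isCovering {v} {k} t≤k k≤v =
  AllP.map⁺ (All.tabulate (λ {p} _ → ∣extendTo∣ k p k≤v)) ,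
  λ T ∣T∣≡t → AnyP.map⁺ (lose (∈-allSubsets T)
                              (p⊆extendTo k T (subst (_≤ k) (sym ∣T∣≡t) t≤k)))

hasCoveringDesign-C : ∀ {v k t} → t ≤ k → k ≤ v → HasCoveringDesign v k t (C v k t)
hasCoveringDesign-C {v} {k} t≤k k≤v =
  C-attained (subst (HasCoveringDesign _ _ _) length≡2^v
                (Vec.fromList blocks , fromList-isCoveringDesign (extendedSubsets-isCovering t≤k k≤v)))
  where
    blocks : List (Subset v)
    blocks = map (extendTo k) (allSubsets v)
    length≡2^v : length blocks ≡ 2 ^ v
    length≡2^v = trans (length-map (extendTo k) (allSubsets v)) (length-allSubsets v)

-- The padding in the `no` branch is never a design when t ≤ k ≤ v; it only makes the
-- length equal to C v k t unconditionally.
optimalDesign : ∀ v k t → List (Subset v)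
optimalDesign v k t with hasCoveringDesign? v k t (C v k t)
... | yes (B , _) = Vec.toList B
... | no  _       = replicate (C v k t) ⊥

length-optimalDesign : ∀ v k t → length (optimalDesign v k t) ≡ C v k t
length-optimalDesign v k t with hasCoveringDesign? v k t (C v k t)
... | yes (B , _) = length-toList B
... | no  _       = length-replicate (C v k t)

optimalDesign-isCovering : ∀ {v k t} → t ≤ k → k ≤ v → IsCoveringList v k t (optimalDesign v k t)
optimalDesign-isCovering {v} {k} {t} t≤k k≤v with hasCoveringDesign? v k t (C v k t)
... | yes (_ , isDesign) = toList-isCoveringList isDesign
... | no  ¬design       = ⊥-elim (¬design (hasCoveringDesign-C t≤k k≤v))

productDesign : ∀ {v₁ v₂} → List (Subset v₁) → List (Subset v₂) → List (Subset (v₁ + v₂))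
productDesign = cartesianProductWith _++_

length-cartesianProductWith : ∀ {A B X : Set} (f : A → B → X) xs ys →
                              length (cartesianProductWith f xs ys) ≡ length xs * length ys
length-cartesianProductWith f []       ys = refl
length-cartesianProductWith f (x ∷ xs) ys =
  trans (length-++ (map (f x) ys))
        (cong₂ _+_ (length-map (f x) ys) (length-cartesianProductWith f xs ys))

productDesign-sizes : ∀ {v₁ v₂ k₁ k₂ t₁ t₂} {Bs₁ : List (Subset v₁)} {Bs₂ : List (Subset v₂)} →
                      IsCoveringList v₁ k₁ t₁ Bs₁ → IsCoveringList v₂ k₂ t₂ Bs₂ →
                      All (λ B → ∣ B ∣ ≡ k₁ + k₂) (productDesign Bs₁ Bs₂)
productDesign-sizes {Bs₁ = Bs₁} {Bs₂} (sizes₁ , _) (sizes₂ , _) =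
  AllP.cartesianProductWith⁺ (setoid _) (setoid _) _++_ Bs₁ Bs₂ λ {B₁} {B₂} B₁∈ B₂∈ →
    trans (∣p++q∣≡∣p∣+∣q∣ B₁ B₂) (cong₂ _+_ (All.lookup sizes₁ B₁∈) (All.lookup sizes₂ B₂∈))

productDesign-covers : ∀ {v₁ v₂ k₁ k₂ t₁ t₂} {Bs₁ : List (Subset v₁)} {Bs₂ : List (Subset v₂)} →
                       IsCoveringList v₁ k₁ t₁ Bs₁ → IsCoveringList v₂ k₂ t₂ Bs₂ →
                       ∀ T₁ T₂ → ∣ T₁ ∣ ≡ t₁ → ∣ T₂ ∣ ≡ t₂ → Any (T₁ ++ T₂ ⊆_) (productDesign Bs₁ Bs₂)
productDesign-covers (_ , covers₁) (_ , covers₂) T₁ T₂ ∣T₁∣≡t₁ ∣T₂∣≡t₂ =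
  AnyP.cartesianProductWith⁺ _++_ ++-⊆ (covers₁ T₁ ∣T₁∣≡t₁) (covers₂ T₂ ∣T₂∣≡t₂)

length-concatMap : ∀ {A B : Set} (f : A → List B) xs →
                   length (concatMap f xs) ≡ sum (map (λ x → length (f x)) xs)
length-concatMap f []       = refl
length-concatMap f (x ∷ xs) = trans (length-++ (f x)) (cong (length (f x) +_) (length-concatMap f xs))

m<n∸o⇒o+m<n : ∀ m n o → m < n ∸ o → o + m < n
m<n∸o⇒o+m<n m n       zero    m<n   = m<n
m<n∸o⇒o+m<n m zero    (suc o) ()
m<n∸o⇒o+m<n m (suc n) (suc o) m<n∸o = s≤s (m<n∸o⇒o+m<n m n o m<n∸o)

∈-range⁻ : ∀ {a b x} → x ∈ range a b → a ≤ x × x ≤ b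
∈-range⁻ {a} {b} x∈ with AnyP.applyUpTo⁻ (a +_) x∈
... | i , i<1+b∸a , refl = m≤m+n a i , s≤s⁻¹ (m<n∸o⇒o+m<n i (suc b) a i<1+b∸a)

∈-range⁺ : ∀ {a b x} → a ≤ x → x ≤ b → x ∈ range a b
∈-range⁺ {a} {b} {x} a≤x x≤b =
  AnyP.applyUpTo⁺ (a +_) {i = x ∸ a} (sym (m+[n∸m]≡n a≤x)) (∸-monoˡ-< (s≤s x≤b) a≤x)

foldr-⊓-attained : ∀ {A : Set} (f : A → ℕ) z xs →
                   foldr _⊓_ z (map f xs) ≡ z ⊎ ∃[ x ] x ∈ xs × foldr _⊓_ z (map f xs) ≡ f x
foldr-⊓-attained f z []       = inj₁ refl
foldr-⊓-attained f z (x ∷ xs) with ⊓-sel (f x) (foldr _⊓_ z (map f xs))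
... | inj₁ min≡fx = inj₂ (x , here refl , min≡fx)
... | inj₂ min≡rest with foldr-⊓-attained f z xs
...   | inj₁ rest≡z             = inj₁ (trans min≡rest rest≡z)
...   | inj₂ (y , y∈xs , rest≡fy) = inj₂ (y , there y∈xs , trans min≡rest rest≡fy)

minRange-attained : ∀ a b f → ∃[ ℓ ] minRange a b f ≡ f ℓ × (a ≤ b → a ≤ ℓ × ℓ ≤ b)
minRange-attained a b f with foldr-⊓-attained f (f a) (range a b)
... | inj₁ min≡fa           = a , min≡fa , λ a≤b → ≤-refl , a≤b
... | inj₂ (ℓ , ℓ∈ , min≡fℓ) = ℓ , min≡fℓ , λ _ → ∈-range⁻ ℓ∈

m∸n≤o⇒m≤n+o : ∀ {m n o} → m ∸ n ≤ o → m ≤ n + o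
m∸n≤o⇒m≤n+o {m} {n} m∸n≤o = ≤-trans (m≤n+m∸n m n) (+-monoʳ-≤ n m∸n≤o)

m∸n≤o⇒m∸o≤n : ∀ {m n o} → m ∸ n ≤ o → m ∸ o ≤ n
m∸n≤o⇒m∸o≤n {m} {n} {o} m∸n≤o =
  m≤n+o⇒m∸n≤o m o (subst (m ≤_) (+-comm n o) (m∸n≤o⇒m≤n+o m∸n≤o))

m∸[m∸n+o]≡n∸o : ∀ {m n} o → n ≤ m → m ∸ (m ∸ n + o) ≡ n ∸ o
m∸[m∸n+o]≡n∸o {m} {n} o n≤m = trans (sym (∸-+-assoc m (m ∸ n) o)) (cong (_∸ o) (m∸[m∸n]≡n n≤m))

module Split (v₁ v₂ k t : ℕ) where

  cost : ℕ → ℕ → ℕ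
  cost s ℓ = C v₁ ℓ s * C v₂ (k ∸ ℓ) (t ∸ s)

  ℓ-min ℓ-max : ℕ → ℕ
  ℓ-min s = s ⊔ (k ∸ v₂)
  ℓ-max s = (k ∸ t + s) ⊓ v₁

  bestℓ : ℕ → ℕ
  bestℓ s = proj₁ (minRange-attained (ℓ-min s) (ℓ-max s) (cost s))

  blocksFor : ℕ → List (Subset (v₁ + v₂))
  blocksFor s = productDesign (optimalDesign v₁ (bestℓ s) s) (optimalDesign v₂ (k ∸ bestℓ s) (t ∸ s))

  design : List (Subset (v₁ + v₂))
  design = concatMap blocksFor (range (t ∸ v₂) (t ⊓ v₁))

  length-blocksFor : ∀ s → length (blocksFor s) ≡ minRange (ℓ-min s) (ℓ-max s) (cost s)
  length-blocksFor s = begin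
    length (blocksFor s)
      ≡⟨ length-cartesianProductWith _++_ (optimalDesign v₁ ℓ s) (optimalDesign v₂ (k ∸ ℓ) (t ∸ s)) ⟩
    length (optimalDesign v₁ ℓ s) * length (optimalDesign v₂ (k ∸ ℓ) (t ∸ s))
      ≡⟨ cong₂ _*_ (length-optimalDesign v₁ ℓ s) (length-optimalDesign v₂ (k ∸ ℓ) (t ∸ s)) ⟩
    cost s ℓ
      ≡⟨ sym (proj₁ (proj₂ (minRange-attained (ℓ-min s) (ℓ-max s) (cost s)))) ⟩
    minRange (ℓ-min s) (ℓ-max s) (cost s) ∎
    where
      open ≡-Reasoning
      ℓ : ℕ
      ℓ = bestℓ s

  length-design : length design ≡ sumRange (t ∸ v₂) (t ⊓ v₁) (λ s → minRange (ℓ-min s) (ℓ-max s) (cost s))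
  length-design = trans (length-concatMap blocksFor (range (t ∸ v₂) (t ⊓ v₁)))
                        (cong sum (map-cong length-blocksFor (range (t ∸ v₂) (t ⊓ v₁))))

  module _ (t≤k : t ≤ k) (k≤v : k ≤ v₁ + v₂) where

    module Admissible {s} (t∸v₂≤s : t ∸ v₂ ≤ s) (s≤t⊓v₁ : s ≤ t ⊓ v₁) where

      s≤t : s ≤ t
      s≤t = ≤-trans s≤t⊓v₁ (m⊓n≤m t v₁)

      k∸[k∸t+s]≡t∸s : k ∸ (k ∸ t + s) ≡ t ∸ s
      k∸[k∸t+s]≡t∸s = m∸[m∸n+o]≡n∸o s t≤k

      ℓ-min≤ℓ-max : ℓ-min s ≤ ℓ-max s
      ℓ-min≤ℓ-max = ⊔-lub (⊓-glb (m≤n+m s (k ∸ t)) (≤-trans s≤t⊓v₁ (m⊓n≤n t v₁)))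
                          (⊓-glb k∸v₂≤k∸t+s (m≤n+o⇒m∸n≤o k v₂ (subst (k ≤_) (+-comm v₁ v₂) k≤v)))
        where
          k∸v₂≤k∸t+s : k ∸ v₂ ≤ k ∸ t + s
          k∸v₂≤k∸t+s = m∸n≤o⇒m∸o≤n (subst (_≤ v₂) (sym k∸[k∸t+s]≡t∸s) (m∸n≤o⇒m∸o≤n t∸v₂≤s))

      ℓ : ℕ
      ℓ = bestℓ s

      ℓ-bounds : ℓ-min s ≤ ℓ × ℓ ≤ ℓ-max s
      ℓ-bounds = proj₂ (proj₂ (minRange-attained (ℓ-min s) (ℓ-max s) (cost s))) ℓ-min≤ℓ-max

      ℓ≤k∸t+s : ℓ ≤ k ∸ t + s
      ℓ≤k∸t+s = ≤-trans (proj₂ ℓ-bounds) (m⊓n≤m _ v₁)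

      first-isCovering : IsCoveringList v₁ ℓ s (optimalDesign v₁ ℓ s)
      first-isCovering = optimalDesign-isCovering (≤-trans (m≤m⊔n s _) (proj₁ ℓ-bounds))
                                                  (≤-trans (proj₂ ℓ-bounds) (m⊓n≤n _ v₁))

      second-isCovering : IsCoveringList v₂ (k ∸ ℓ) (t ∸ s) (optimalDesign v₂ (k ∸ ℓ) (t ∸ s))
      second-isCovering = optimalDesign-isCovering
        (subst (_≤ k ∸ ℓ) k∸[k∸t+s]≡t∸s (∸-monoʳ-≤ k ℓ≤k∸t+s))
        (m∸n≤o⇒m∸o≤n (≤-trans (m≤n⊔m s (k ∸ v₂)) (proj₁ ℓ-bounds)))

      ℓ+[k∸ℓ]≡k : ℓ + (k ∸ ℓ) ≡ k
      ℓ+[k∸ℓ]≡k = m+[n∸m]≡n (≤-trans ℓ≤k∸t+s (≤-trans (+-monoʳ-≤ (k ∸ t) s≤t) (≤-reflexive (m∸n+n≡m t≤k))))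

      blocksFor-sizes : All (λ B → ∣ B ∣ ≡ k) (blocksFor s)
      blocksFor-sizes = All.map (λ ∣B∣≡ → trans ∣B∣≡ ℓ+[k∸ℓ]≡k)
                                (productDesign-sizes first-isCovering second-isCovering)

    design-sizes : All (λ B → ∣ B ∣ ≡ k) design
    design-sizes = AllP.concat⁺ (AllP.map⁺ (All.tabulate λ s∈ →
      let (t∸v₂≤s , s≤t⊓v₁) = ∈-range⁻ s∈ in Admissible.blocksFor-sizes t∸v₂≤s s≤t⊓v₁))

    design-covers : ∀ T → ∣ T ∣ ≡ t → Any (T ⊆_) design
    design-covers T ∣T∣≡t with splitAt v₁ T
    ... | T₁ , T₂ , refl = AnyP.concatMap⁺ blocksFor (lose (∈-range⁺ t∸v₂≤s s≤t⊓v₁) T⊆block)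
      where
        s : ℕ
        s = ∣ T₁ ∣
        s+∣T₂∣≡t : s + ∣ T₂ ∣ ≡ t
        s+∣T₂∣≡t = trans (sym (∣p++q∣≡∣p∣+∣q∣ T₁ T₂)) ∣T∣≡t
        t∸v₂≤s : t ∸ v₂ ≤ s
        t∸v₂≤s = subst (t ∸ v₂ ≤_) (trans (cong (_∸ ∣ T₂ ∣) (sym s+∣T₂∣≡t)) (m+n∸n≡m s ∣ T₂ ∣))
                       (∸-monoʳ-≤ t (∣p∣≤n T₂))
        s≤t⊓v₁ : s ≤ t ⊓ v₁
        s≤t⊓v₁ = ⊓-glb (subst (s ≤_) s+∣T₂∣≡t (m≤m+n s ∣ T₂ ∣)) (∣p∣≤n T₁)
        ∣T₂∣≡t∸s : ∣ T₂ ∣ ≡ t ∸ s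
        ∣T₂∣≡t∸s = trans (sym (m+n∸m≡n s ∣ T₂ ∣)) (cong (_∸ s) s+∣T₂∣≡t)
        open Admissible t∸v₂≤s s≤t⊓v₁
        T⊆block : Any (T₁ ++ T₂ ⊆_) (blocksFor s)
        T⊆block = productDesign-covers first-isCovering second-isCovering T₁ T₂ refl ∣T₂∣≡t∸s

mainTheorem1 : (v₁ v₂ k t : ℕ) → t ≤ k → k ≤ v₁ + v₂ →
    C (v₁ + v₂) k t ≤
      sumRange (t ∸ v₂) (t ⊓ v₁) (λ s →
        minRange (s ⊔ (k ∸ v₂)) ((k ∸ t + s) ⊓ v₁) (λ ℓ →
          C v₁ ℓ s * C v₂ (k ∸ ℓ) (t ∸ s)))
mainTheorem1 v₁ v₂ k t t≤k k≤v = begin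
  C (v₁ + v₂) k t ≤⟨ C≤length (design-sizes t≤k k≤v , design-covers t≤k k≤v) ⟩
  length design   ≡⟨ length-design ⟩
  _               ∎
  where
    open Split v₁ v₂ k t
    open ≤-Reasoning
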